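{- Let $r\geq 2$ and $\ell\geq 3$ be integers. Let $G$ be a hypergraph whose edges have sizes between $2$ and $r$, and suppose $G$ contains no linear cycle of length $\ell$. Then there exists a simple hypergraph $G'$ on $V(G)$ whose edges have sizes between $2$ and $r$ such that $G'$ contains no linear cycle of length $\ell$, $G'$ contains no $(a,r\ell)$-sunflower for any $a\geq 2$, and $\alpha(G')\leq\alpha(G)$.
   Context: A linear cycle of length $\ell$ is a list of sets $A_1,\ldots,A_\ell$ with $|A_i\cap A_{i+1}|=1$ for $i\in[\ell-1]$, $|A_\ell\cap A_1|=1$, and $A_i\cap A_j=\emptyset$ for all other pairs $i\neq j$. A hypergraph is simple if no edge contains another edge. A sunflower with core $C$ is a collection of distinct sets any two of which intersect exactly in $C$; an $(a,p)$-sunflower is one with $p$ members and $|C|=a$. A set $S$ of vertices is independent if no edge is contained in $S$; $\alpha(G)$ is the maximum size of an independent set. -}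

module Defs where

open import Data.Nat using (ℕ; zero; suc; _≤_; _⊔_)
open import Data.Bool using (Bool; true; false; not)
open import Data.Fin using (Fin; toℕ)
open import Data.Fin.Subset using (Subset; _∩_; _⊆_; ∣_∣; ⊥; inside; outside)
open import Data.Fin.Subset.Properties using (_⊆?_)
open import Data.Vec using (_∷_; [])
open import Data.List using (List; []; _∷_; map; _++_; filter; foldr)
open import Data.Bool.ListAction using (any)
open import Data.List.Membership.Propositional using (_∈_)
open import Data.List.Relation.Unary.All using (All)
open import Data.Product using (Σ; _×_; ∃)
open import Data.Sum using (_⊎_)
open import Relation.Binary.PropositionalEquality using (_≡_)
open import Relation.Nullary using (¬_; does)
open import Function.Definitions using (Injective)

record Hypergraph (n : ℕ) : Set where
  constructor hypergraph
  field
    edges : List (Subset n)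
open Hypergraph public

EdgeSizesIn2to : ∀ {n} → ℕ → Hypergraph n → Set
EdgeSizesIn2to r G = All (λ e → (2 ≤ ∣ e ∣) × (∣ e ∣ ≤ r)) (edges G)

CycSucc : ∀ {ℓ} → Fin ℓ → Fin ℓ → Set
CycSucc {ℓ} i j = (suc (toℕ i) ≡ toℕ j) ⊎ ((suc (toℕ i) ≡ ℓ) × (toℕ j ≡ 0))

CycAdj : ∀ {ℓ} → Fin ℓ → Fin ℓ → Set
CycAdj i j = CycSucc i j ⊎ CycSucc j i

IsLinearCycle : ∀ {n} (ℓ : ℕ) → (Fin ℓ → Subset n) → Set
IsLinearCycle ℓ A =
  ∀ i j → ¬ (i ≡ j) →
    (CycAdj i j → ∣ A i ∩ A j ∣ ≡ 1) × (¬ CycAdj i j → A i ∩ A j ≡ ⊥)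

HasLinearCycle : ∀ {n} → ℕ → Hypergraph n → Set
HasLinearCycle {n} ℓ G =
  Σ (Fin ℓ → Subset n) λ A → (∀ i → A i ∈ edges G) × IsLinearCycle ℓ A

IsSimple : ∀ {n} → Hypergraph n → Set
IsSimple G = ∀ {e f} → e ∈ edges G → f ∈ edges G → e ⊆ f → e ≡ f

HasSunflower : ∀ {n} → ℕ → ℕ → Hypergraph n → Set
HasSunflower {n} a p G =
  Σ (Fin p → Subset n) λ S → Σ (Subset n) λ C →
    (∀ i → S i ∈ edges G) × Injective _≡_ _≡_ S × (∣ C ∣ ≡ a) ×
    (∀ i j → ¬ (i ≡ j) → S i ∩ S j ≡ C)

allSubsets : ∀ n → List (Subset n)
allSubsets zero = [] ∷ []
allSubsets (suc n) =
  map (outside ∷_) (allSubsets n) ++ map (inside ∷_) (allSubsets n)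

isIndependent : ∀ {n} → Hypergraph n → Subset n → Bool
isIndependent G S = not (any (λ e → does (e ⊆? S)) (edges G))

α : ∀ {n} → Hypergraph n → ℕ
α {n} G = foldr _⊔_ 0 (map ∣_∣ (filter (λ S → isIndependent G S Data.Bool.≟ true) (allSubsets n)))

-- Repeatedly replace all edges containing a set C by C itself, where 2 ≤ |C| ≤ r,
-- C lies strictly inside some edge, and the replacement creates no linear ℓ-cycle.
-- Each step lowers the total edge size, keeps edge sizes in [2, r] and keeps some
-- new edge inside every old one, so α never grows. When no such C remains, the
-- hypergraph is simple (an edge inside another edge would be such a C) and has no
-- (a, rℓ)-sunflower with a ≥ 2, because its core would be such a C: in a linear
-- ℓ-cycle through the core the other ℓ - 1 edges cover at most (ℓ - 1) r < rℓ
-- vertices and petals are disjoint outside the core, so some petal meets them only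
-- inside the core and can take its place, giving a linear ℓ-cycle before the
-- replacement.
module Submission where

open import Defs
open import Data.Nat using (ℕ; _≤_; _*_)
open import Data.Product using (Σ; _×_)
open import Relation.Nullary using (¬_)

open import Data.Bool using (true; false; not; T)
import Data.Bool as Bool
open import Data.Bool.ListAction using (any)
open import Data.Bool.Properties using (T-≡)
open import Data.Empty using (⊥-elim)
open import Data.Fin using (Fin; zero; suc; toℕ; punchIn; punchOut)
open import Data.Fin.Properties
  using (all?; any?; ¬∀⟶∃¬; pigeonhole; <⇒≢; punchInᵢ≢i; punchIn-punchOut)
  renaming (_≟_ to _≟ᶠ_)
open import Data.Fin.Subset
  using (Subset; inside; outside; _∩_; _⊆_; _⊂_; ∣_∣)
  renaming (_∈_ to _∈ₛ_; _∉_ to _∉ₛ_; ⊥ to ∅)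
open import Data.Fin.Subset.Properties
  using ( _⊆?_; _⊂?_; ⊆-refl; ⊆-trans; ⊆-antisym; drop-∷-⊆; out⊂; out⊂in; in⊂in
        ; p⊂q⇒∣p∣<∣q∣; p⊆q⇒∣p∣≤∣q∣; p∩q⊆p; x∈p∩q⁺; x∈p∩q⁻; ∩-comm; ∩-idem
        ; ∣⊥∣≡0; anySubset?)
  renaming (_∈?_ to _∈ₛ?_)
open import Data.List using (List; []; _∷_; map; filter; concat; tabulate; length; lookup)
open import Data.List.Properties
  using (length-map; length-++; foldr-preservesᵇ; foldr-preservesᵒ)
open import Data.List.Membership.Propositional using (_∈_; lose; find)
open import Data.List.Membership.Propositional.Properties
  using (∈-map⁺; ∈-map⁻; ∈-filter⁺; ∈-filter⁻; ∈-concat⁺′; ∈-tabulate⁺)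
open import Data.List.Relation.Unary.All as All using (_∷_)
open import Data.List.Relation.Unary.All.Properties as All using ()
open import Data.List.Relation.Unary.Any as Any using (Any; here; there)
open import Data.List.Relation.Unary.Any.Properties using (any⁺; any⁻; lookup-index)
open import Data.Nat as ℕ using (zero; suc; _<_; _+_; z≤n; s≤s)
open import Data.Nat.Induction using (<-wellFounded)
open import Data.Nat.ListAction using (sum)
open import Data.Nat.Properties
  using ( +-commutativeSemigroup; ≤-refl; ≤-reflexive; ≤-trans; <-≤-trans; ≤-<-trans
        ; +-mono-≤; +-monoʳ-≤; +-monoˡ-<; m≤n+m; m<n+m; <⇒≱; *-comm; *-suc; *-mono-≤
        ; ⊔-lub; m≤n⇒m≤n⊔o; m≤n⇒m≤o⊔n; module ≤-Reasoning)
open import Data.Product using (∃; _,_; proj₁; proj₂)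
open import Data.Sum using (inj₂; [_,_])
open import Data.Vec using ([]; _∷_; here; there)
open import Data.Vec.Properties using (≡-dec)
open import Data.Vec.Functional using (updateAt; head; tail) renaming (_∷_ to _◂_)
open import Data.Vec.Functional.Properties using (updateAt-updates; updateAt-minimal)
open import Function using (_∘_; const; Equivalence)
open import Function.Definitions using (Injective)
open import Induction.WellFounded using (Acc; acc)
open import Level using (0ℓ)
open import Relation.Binary using (DecidableEquality)
open import Relation.Binary.PropositionalEquality hiding ([_])
open import Relation.Nullary using (Dec; yes; no; does; contradiction)
open import Relation.Nullary.Decidable
  using ( map′; ¬?; _×-dec_; _⊎-dec_; _→-dec_
        ; toWitness; dec-true; isYes≗does; decidable-stable)
open import Relation.Unary using (Pred; Decidable)
open import Algebra.Properties.CommutativeSemigroup +-commutativeSemigroup using (x∙yz≈y∙xz)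

private
  variable
    n m p r ℓ : ℕ

infix 4 _≟ₛ_
_≟ₛ_ : DecidableEquality (Subset n)
_≟ₛ_ = ≡-dec Bool._≟_

Searchable : Set → Set₁
Searchable A = ∀ {P : Pred A 0ℓ} → Decidable P → Dec (∃ P)

-- Pointwise equal families need not be equal (no function extensionality),
-- so P has to be transported along _≗_ explicitly.
anyFamily? : ∀ {A : Set} m → Searchable A → {P : Pred (Fin m → A) 0ℓ} →
             (∀ {f g} → f ≗ g → P f → P g) → Decidable P → Dec (∃ P)
anyFamily? zero    search resp P? =
  map′ (λ p → _ , p) (λ (f , p) → resp (λ ()) p) (P? (λ ()))
anyFamily? (suc m) search resp P? =
  map′ (λ (x , f , p) → x ◂ f , p)
       (λ (f , p) → head f , tail f , resp (λ { zero → refl ; (suc i) → refl }) p)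
       (search λ x → anyFamily? m search
         (λ f≗g → resp λ { zero → refl ; (suc i) → f≗g i }) (P? ∘ (x ◂_)))

cycSucc? : (i j : Fin ℓ) → Dec (CycSucc i j)
cycSucc? {ℓ} i j =
  (suc (toℕ i) ℕ.≟ toℕ j) ⊎-dec ((suc (toℕ i) ℕ.≟ ℓ) ×-dec (toℕ j ℕ.≟ 0))

cycAdj? : (i j : Fin ℓ) → Dec (CycAdj i j)
cycAdj? i j = cycSucc? i j ⊎-dec cycSucc? j i

isLinearCycle? : ∀ ℓ (A : Fin ℓ → Subset n) → Dec (IsLinearCycle ℓ A)
isLinearCycle? ℓ A = all? λ i → all? λ j → ¬? (i ≟ᶠ j) →-dec
  ((cycAdj? i j →-dec (∣ A i ∩ A j ∣ ℕ.≟ 1)) ×-dec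
   (¬? (cycAdj? i j) →-dec (A i ∩ A j ≟ₛ ∅)))

isLinearCycle-resp-≗ : {A B : Fin ℓ → Subset n} → A ≗ B →
                       IsLinearCycle ℓ A → IsLinearCycle ℓ B
isLinearCycle-resp-≗ A≗B lc i j i≢j =
  (λ adj → subst₂ (λ X Y → ∣ X ∩ Y ∣ ≡ 1) (A≗B i) (A≗B j) (proj₁ (lc i j i≢j) adj)) ,
  (λ ¬adj → subst₂ (λ X Y → X ∩ Y ≡ ∅) (A≗B i) (A≗B j) (proj₂ (lc i j i≢j) ¬adj))

hasLinearCycle? : ∀ ℓ (G : Hypergraph n) → Dec (HasLinearCycle ℓ G)
hasLinearCycle? ℓ G = anyFamily? ℓ anySubset?
  (λ A≗B (A∈ , lc) →
    (λ i → subst (_∈ edges G) (A≗B i) (A∈ i)) , isLinearCycle-resp-≗ A≗B lc)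
  (λ A → all? (λ i → Any.any? (A i ≟ₛ_) (edges G)) ×-dec isLinearCycle? ℓ A)

⊆∧≢⇒⊂ : {P Q : Subset n} → P ⊆ Q → P ≢ Q → P ⊂ Q
⊆∧≢⇒⊂ {P = []}          {[]}          _   P≢Q = contradiction refl P≢Q
⊆∧≢⇒⊂ {P = outside ∷ P} {outside ∷ Q} P⊆Q P≢Q =
  out⊂ (⊆∧≢⇒⊂ (drop-∷-⊆ P⊆Q) (P≢Q ∘ cong (outside ∷_)))
⊆∧≢⇒⊂ {P = outside ∷ P} {inside  ∷ Q} P⊆Q _   = out⊂in (drop-∷-⊆ P⊆Q)
⊆∧≢⇒⊂ {P = inside  ∷ P} {outside ∷ Q} P⊆Q _   = contradiction (P⊆Q here) λ ()
⊆∧≢⇒⊂ {P = inside  ∷ P} {inside  ∷ Q} P⊆Q P≢Q =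
  in⊂in (⊆∧≢⇒⊂ (drop-∷-⊆ P⊆Q) (P≢Q ∘ cong (inside ∷_)))

elements : Subset n → List (Fin n)
elements []            = []
elements (inside  ∷ P) = zero ∷ map suc (elements P)
elements (outside ∷ P) = map suc (elements P)

length-elements : (P : Subset n) → length (elements P) ≡ ∣ P ∣
length-elements []            = refl
length-elements (inside  ∷ P) =
  cong suc (trans (length-map suc (elements P)) (length-elements P))
length-elements (outside ∷ P) = trans (length-map suc (elements P)) (length-elements P)

∈-elements : {x : Fin n} (P : Subset n) → x ∈ₛ P → x ∈ elements P
∈-elements (inside  ∷ P) here        = here refl
∈-elements (inside  ∷ P) (there x∈P) = there (∈-map⁺ suc (∈-elements P x∈P))
∈-elements (outside ∷ P) (there x∈P) = ∈-map⁺ suc (∈-elements P x∈P)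

length-concat-tabulate : ∀ {A : Set} (h : Fin m → List A) →
                         (∀ j → length (h j) ≤ r) → length (concat (tabulate h)) ≤ m * r
length-concat-tabulate {m = zero}  h short = z≤n
length-concat-tabulate {m = suc m} h short =
  ≤-trans (≤-reflexive (length-++ (h zero)))
          (+-mono-≤ (short zero) (length-concat-tabulate (h ∘ suc) (short ∘ suc)))

module _ {A : Set} {P : Pred A 0ℓ} (P? : Decidable P) (f : A → ℕ) where

  sum-map-filter : ∀ xs → sum (map f (filter P? xs)) ≤ sum (map f xs)
  sum-map-filter []       = z≤n
  sum-map-filter (y ∷ ys) with does (P? y)
  ... | true  = +-monoʳ-≤ (f y) (sum-map-filter ys)
  ... | false = ≤-trans (sum-map-filter ys) (m≤n+m _ (f y))

  sum-map-filter-drop : ∀ {x} xs → x ∈ xs → ¬ P x →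
                        f x + sum (map f (filter P? xs)) ≤ sum (map f xs)
  sum-map-filter-drop {x} (y ∷ ys) (here refl) ¬Px with P? x
  ... | yes Px = contradiction Px ¬Px
  ... | no  _  = +-monoʳ-≤ (f x) (sum-map-filter ys)
  sum-map-filter-drop {x} (y ∷ ys) (there x∈) ¬Px with does (P? y)
  ... | true  = ≤-trans (≤-reflexive (x∙yz≈y∙xz (f x) (f y) _))
                        (+-monoʳ-≤ (f y) (sum-map-filter-drop ys x∈ ¬Px))
  ... | false = ≤-trans (sum-map-filter-drop ys x∈ ¬Px) (m≤n+m _ (f y))

isIndependent⁻ : {G : Hypergraph n} {S e : Subset n} →
                 isIndependent G S ≡ true → e ∈ edges G → ¬ e ⊆ S
isIndependent⁻ {G = G} {S} independent e∈G e⊆S =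
  contradiction (subst (λ b → not b ≡ true) (Equivalence.to T-≡ someEdgeInside) independent)
                λ ()
  where
  someEdgeInside : T (any (λ e → does (e ⊆? S)) (edges G))
  someEdgeInside = any⁺ _ (lose e∈G (Equivalence.from T-≡ (dec-true (_ ⊆? S) e⊆S)))

isIndependent⁺ : {G : Hypergraph n} {S : Subset n} →
                 (∀ {e} → e ∈ edges G → ¬ e ⊆ S) → isIndependent G S ≡ true
isIndependent⁺ {G = G} {S} noEdgeInside with any (λ e → does (e ⊆? S)) (edges G) in eq
... | false = refl
... | true  with find (any⁻ _ (edges G) (Equivalence.from T-≡ eq))
... | e , e∈G , e⊆S =
  ⊥-elim (noEdgeInside e∈G (toWitness (subst T (sym (isYes≗does (e ⊆? S))) e⊆S)))

α-mono : {G′ G : Hypergraph n} →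
         (∀ S → isIndependent G′ S ≡ true → isIndependent G S ≡ true) → α G′ ≤ α G
α-mono {n} {G′} {G} indep⇒indep =
  foldr-preservesᵇ {P = _≤ α G} ⊔-lub z≤n (All.tabulate λ y∈ → bounded (∈-map⁻ ∣_∣ y∈))
  where
  independents : Hypergraph n → List (Subset n)
  independents H = filter (λ S → isIndependent H S Bool.≟ true) (allSubsets n)
  bounded : ∀ {y} → ∃ (λ S → S ∈ independents G′ × y ≡ ∣ S ∣) → y ≤ α G
  bounded (S , S∈ , refl)
    with ∈-filter⁻ (λ S → isIndependent G′ S Bool.≟ true) {xs = allSubsets n} S∈
  ... | S∈all , independent =
    foldr-preservesᵒ {P = ∣ S ∣ ≤_} (λ _ _ → [ m≤n⇒m≤n⊔o _ , m≤n⇒m≤o⊔n _ ])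
      0 (map ∣_∣ (independents G))
      (inj₂ (lose (∈-map⁺ ∣_∣ (∈-filter⁺ (λ S → isIndependent G S Bool.≟ true) S∈all
                                          (indep⇒indep S independent))) ≤-refl))

Refines : Hypergraph n → Hypergraph n → Set
Refines {n} G′ G = ∀ {e} → e ∈ edges G → ∃ λ (f : Subset n) → f ∈ edges G′ × f ⊆ e

refines-refl : {G : Hypergraph n} → Refines G G
refines-refl e∈G = _ , e∈G , ⊆-refl

refines-trans : {G″ G′ G : Hypergraph n} → Refines G″ G′ → Refines G′ G → Refines G″ G
refines-trans G″≼G′ G′≼G e∈G with G′≼G e∈G
... | f , f∈G′ , f⊆e with G″≼G′ f∈G′
... | g , g∈G″ , g⊆f = g , g∈G″ , ⊆-trans g⊆f f⊆e

α-refines : {G′ G : Hypergraph n} → Refines G′ G → α G′ ≤ α G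
α-refines {G′ = G′} {G} G′≼G = α-mono {G′ = G′} {G} λ S independent →
  isIndependent⁺ {G = G} λ e∈G e⊆S →
    let f , f∈G′ , f⊆e = G′≼G e∈G in
    isIndependent⁻ {G = G′} independent f∈G′ (⊆-trans f⊆e e⊆S)

linearCycle-∣∩∣≤1 : {A : Fin ℓ → Subset n} → IsLinearCycle ℓ A →
                    ∀ {i j} → i ≢ j → ∣ A i ∩ A j ∣ ≤ 1
linearCycle-∣∩∣≤1 {n = n} {A} lc {i} {j} i≢j with cycAdj? i j
... | yes adj  = ≤-reflexive (proj₁ (lc i j i≢j) adj)
... | no  ¬adj =
  ≤-trans (≤-reflexive (trans (cong ∣_∣ (proj₂ (lc i j i≢j) ¬adj)) (∣⊥∣≡0 n))) z≤n

linearCycle-repeat : {A : Fin ℓ → Subset n} → IsLinearCycle ℓ A →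
                     ∀ {i j} → i ≢ j → A i ≡ A j → ∣ A i ∣ ≤ 1
linearCycle-repeat {A = A} lc {i} i≢j Ai≡Aj = subst (λ X → ∣ X ∣ ≤ 1)
  (trans (cong (A i ∩_) (sym Ai≡Aj)) (∩-idem (A i))) (linearCycle-∣∩∣≤1 lc i≢j)

linearCycle-updateAt : {A : Fin ℓ → Subset n} {X : Subset n} (i : Fin ℓ) →
                       (∀ j → j ≢ i → X ∩ A j ≡ A i ∩ A j) →
                       IsLinearCycle ℓ A → IsLinearCycle ℓ (updateAt A i (const X))
linearCycle-updateAt {A = A} {X} i agree lc j k j≢k =
  (λ adj → subst (λ Y → ∣ Y ∣ ≡ 1) (sym (∩-preserved j k j≢k)) (proj₁ (lc j k j≢k) adj)) ,
  (λ ¬adj → trans (∩-preserved j k j≢k) (proj₂ (lc j k j≢k) ¬adj))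
  where
  B = updateAt A i (const X)
  unchanged : ∀ j → j ≢ i → B j ≡ A j
  unchanged j j≢i = updateAt-minimal j i A j≢i
  ∩-preserved : ∀ j k → j ≢ k → B j ∩ B k ≡ A j ∩ A k
  ∩-preserved j k j≢k with j ≟ᶠ i | k ≟ᶠ i
  ... | yes refl | yes refl = contradiction refl j≢k
  ... | yes refl | no  k≢i  =
    trans (cong₂ _∩_ (updateAt-updates i A) (unchanged k k≢i)) (agree k k≢i)
  ... | no  j≢i  | yes refl = begin
    B j ∩ B i ≡⟨ cong₂ _∩_ (unchanged j j≢i) (updateAt-updates i A) ⟩
    A j ∩ X   ≡⟨ ∩-comm (A j) X ⟩
    X ∩ A j   ≡⟨ agree j j≢i ⟩
    A i ∩ A j ≡⟨ ∩-comm (A i) (A j) ⟩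
    A j ∩ A i ∎
    where open ≡-Reasoning
  ... | no  j≢i  | no  k≢i  = cong₂ _∩_ (unchanged j j≢i) (unchanged k k≢i)

linearCycle-mono : {H G : Hypergraph n} → (∀ {e} → e ∈ edges H → e ∈ edges G) →
                   HasLinearCycle ℓ H → HasLinearCycle ℓ G
linearCycle-mono H⊆G (A , A∈H , lc) = A , H⊆G ∘ A∈H , lc

IsSunflower : (Fin p → Subset n) → Subset n → Set
IsSunflower S C = ∀ k k′ → k ≢ k′ → S k ∩ S k′ ≡ C

another : 2 ≤ p → (k : Fin p) → ∃ λ k′ → k ≢ k′
another (s≤s (s≤s _)) zero    = suc zero , λ ()
another (s≤s (s≤s _)) (suc k) = zero , λ ()

core⊆petal : {S : Fin p → Subset n} {C : Subset n} →
             2 ≤ p → IsSunflower S C → ∀ k → C ⊆ S k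
core⊆petal {S = S} 2≤p sunflower k =
  let k′ , k≢k′ = another 2≤p k in
  subst (_⊆ S k) (sunflower k k′ k≢k′) (p∩q⊆p (S k) (S k′))

core⊂petal : {S : Fin p → Subset n} {C : Subset n} → 2 ≤ p →
             IsSunflower S C → Injective _≡_ _≡_ S → ∃ λ k → C ⊂ S k
core⊂petal {S = S} {C} 2≤p@(s≤s (s≤s _)) sunflower injective
  with another 2≤p zero | C ≟ₛ S zero
... | _ , _    | no  C≢S₀ = zero , ⊆∧≢⇒⊂ (core⊆petal 2≤p sunflower zero) C≢S₀
... | k , 0≢k  | yes C≡S₀ =
  k , ⊆∧≢⇒⊂ (core⊆petal 2≤p sunflower k) (λ C≡Sₖ → 0≢k (injective (trans (sym C≡S₀) C≡Sₖ)))

module _ (S : Fin p → Subset n) {C : Subset n} (sunflower : IsSunflower S C) where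

  InPetalOutsideCore : Fin p → Fin n → Set
  InPetalOutsideCore k v = v ∈ₛ S k × v ∉ₛ C

  inPetalOutsideCore? : ∀ k v → Dec (InPetalOutsideCore k v)
  inPetalOutsideCore? k v = (v ∈ₛ? S k) ×-dec ¬? (v ∈ₛ? C)

  -- Pigeonhole: a vertex outside the core lies in at most one petal.
  petals-not-all-hit : (L : List (Fin n)) → length L < p →
                       ¬ (∀ k → Any (InPetalOutsideCore k) L)
  petals-not-all-hit L short hits with pigeonhole short (Any.index ∘ hits)
  ... | k , k′ , k<k′ , sameIndex = proj₂ hitₖ (subst (_ ∈ₛ_) (sunflower k k′ (<⇒≢ k<k′))
        (x∈p∩q⁺ (proj₁ hitₖ ,
                 subst (_∈ₛ S k′) (cong (lookup L) (sym sameIndex)) (proj₁ hitₖ′))))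
    where
    hitₖ  = lookup-index (hits k)
    hitₖ′ = lookup-index (hits k′)

  petal-avoiding : (L : List (Fin n)) → length L < p →
                   ∃ λ k → ∀ {v} → v ∈ L → v ∈ₛ S k → v ∈ₛ C
  petal-avoiding L short with all? (λ k → Any.any? (inPetalOutsideCore? k) L)
  ... | yes hits = contradiction hits (petals-not-all-hit L short)
  ... | no ¬hits =
    let k , unhit = ¬∀⟶∃¬ p _ (λ k → Any.any? (inPetalOutsideCore? k) L) ¬hits in
    k , λ v∈L v∈Sₖ → decidable-stable (_ ∈ₛ? C) (λ v∉C → unhit (lose v∈L (v∈Sₖ , v∉C)))

shrink : Subset n → Hypergraph n → Hypergraph n
shrink C H = hypergraph (C ∷ filter (λ e → ¬? (C ⊆? e)) (edges H))

∈-shrink-≢ : {C e : Subset n} {H : Hypergraph n} →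
             e ∈ edges (shrink C H) → e ≢ C → e ∈ edges H
∈-shrink-≢ (here e≡C)  e≢C = contradiction e≡C e≢C
∈-shrink-≢ (there e∈)  _   = proj₁ (∈-filter⁻ (λ e → ¬? (_ ⊆? e)) e∈)

shrink-refines : {C : Subset n} {H : Hypergraph n} → Refines (shrink C H) H
shrink-refines {C = C} {e = e} e∈H with C ⊆? e
... | yes C⊆e = C , here refl , C⊆e
... | no  C⊈e = e , there (∈-filter⁺ (λ e → ¬? (C ⊆? e)) e∈H C⊈e) , ⊆-refl

shrink-edgeSizes : {C : Subset n} {H : Hypergraph n} → 2 ≤ ∣ C ∣ → ∣ C ∣ ≤ r →
                   EdgeSizesIn2to r H → EdgeSizesIn2to r (shrink C H)
shrink-edgeSizes 2≤C C≤r sizes = (2≤C , C≤r) ∷ All.filter⁺ _ sizes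

shrink-edge-linearCycleFree : {C : Subset n} {H : Hypergraph n} → C ∈ edges H →
                              ¬ HasLinearCycle ℓ H → ¬ HasLinearCycle ℓ (shrink C H)
shrink-edge-linearCycleFree {C = C} C∈H noCycle = noCycle ∘ linearCycle-mono λ where
  (here refl) → C∈H
  (there e∈)  → proj₁ (∈-filter⁻ (λ e → ¬? (C ⊆? e)) e∈)

weight : Hypergraph n → ℕ
weight H = sum (map ∣_∣ (edges H))

weight-shrink : {C k : Subset n} {H : Hypergraph n} → C ⊂ k → k ∈ edges H →
                weight (shrink C H) < weight H
weight-shrink {C = C} {k} {H} C⊂k k∈H =
  <-≤-trans (+-monoˡ-< _ (p⊂q⇒∣p∣<∣q∣ C⊂k))
            (sum-map-filter-drop (λ e → ¬? (C ⊆? e)) ∣_∣ (edges H) k∈H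
                                 λ C⊈k → C⊈k (proj₁ C⊂k))

module _ {H : Hypergraph n} {C : Subset n} (S : Fin p → Subset n)
         (rank : ∀ {e} → e ∈ edges H → ∣ e ∣ ≤ r) (S∈H : ∀ k → S k ∈ edges H)
         (sunflower : IsSunflower S C) (C⊆S : ∀ k → C ⊆ S k)
         where

  core-replaceable : (A : Fin ℓ → Subset n) (i : Fin ℓ) → A i ≡ C →
                     (∀ j → j ≢ i → A j ∈ edges H) → IsLinearCycle ℓ A →
                     ℕ.pred ℓ * r < p → HasLinearCycle ℓ H
  core-replaceable {ℓ = suc m} A i Ai≡C A∈H lc fewerThanPetals =
    updateAt A i (const (S k)) , replaced∈H , linearCycle-updateAt i agree lc
    where
    others : List (Fin n)
    others = concat (tabulate (elements ∘ A ∘ punchIn i))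

    ∈-others : ∀ {v j} → j ≢ i → v ∈ₛ A j → v ∈ others
    ∈-others {j = j} j≢i v∈Aⱼ = ∈-concat⁺′ (∈-elements (A j) v∈Aⱼ)
      (subst (λ j → elements (A j) ∈ tabulate (elements ∘ A ∘ punchIn i))
             (punchIn-punchOut (j≢i ∘ sym)) (∈-tabulate⁺ (punchOut (j≢i ∘ sym))))

    others-short : length others < p
    others-short = ≤-<-trans (length-concat-tabulate _ λ j →
      ≤-trans (≤-reflexive (length-elements (A (punchIn i j))))
              (rank (A∈H _ (punchInᵢ≢i i j))))
      fewerThanPetals

    k = proj₁ (petal-avoiding S sunflower others others-short)
    avoids = proj₂ (petal-avoiding S sunflower others others-short)

    agree : ∀ j → j ≢ i → S k ∩ A j ≡ A i ∩ A j
    agree j j≢i = ⊆-antisym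
      (λ v∈ → let v∈Sₖ , v∈Aⱼ = x∈p∩q⁻ (S k) (A j) v∈ in
        x∈p∩q⁺ (subst (_ ∈ₛ_) (sym Ai≡C) (avoids (∈-others j≢i v∈Aⱼ) v∈Sₖ) , v∈Aⱼ))
      (λ v∈ → let v∈Aᵢ , v∈Aⱼ = x∈p∩q⁻ (A i) (A j) v∈ in
        x∈p∩q⁺ (C⊆S k (subst (_ ∈ₛ_) Ai≡C v∈Aᵢ) , v∈Aⱼ))

    replaced∈H : ∀ j → updateAt A i (const (S k)) j ∈ edges H
    replaced∈H j with j ≟ᶠ i
    ... | yes refl = subst (_∈ edges H) (sym (updateAt-updates i A)) (S∈H k)
    ... | no  j≢i  = subst (_∈ edges H) (sym (updateAt-minimal j i A j≢i)) (A∈H j j≢i)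

  shrink-core-linearCycleFree : 2 ≤ ∣ C ∣ → ℕ.pred ℓ * r < p →
                                ¬ HasLinearCycle ℓ H → ¬ HasLinearCycle ℓ (shrink C H)
  shrink-core-linearCycleFree 2≤C fewerThanPetals noCycle (A , A∈ , lc)
    with any? (λ i → A i ≟ₛ C)
  ... | no  A≢C        = noCycle (A , (λ i → ∈-shrink-≢ (A∈ i) (A≢C ∘ (i ,_))) , lc)
  ... | yes (i , Aᵢ≡C) = noCycle (core-replaceable A i Aᵢ≡C
          (λ j j≢i → ∈-shrink-≢ (A∈ j) (Aⱼ≢C j≢i)) lc fewerThanPetals)
    where
    Aⱼ≢C : ∀ {j} → j ≢ i → A j ≢ C
    Aⱼ≢C j≢i Aⱼ≡C = <⇒≱ 2≤C
      (subst (λ X → ∣ X ∣ ≤ 1) Aⱼ≡C (linearCycle-repeat lc j≢i (trans Aⱼ≡C (sym Aᵢ≡C))))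

pred*<* : 1 ≤ r → 1 ≤ ℓ → ℕ.pred ℓ * r < r * ℓ
pred*<* {r} {suc m} 1≤r _ = begin-strict
  m * r     ≡⟨ *-comm m r ⟩
  r * m     <⟨ m<n+m (r * m) 1≤r ⟩
  r + r * m ≡⟨ *-suc r m ⟨
  r * suc m ∎
  where open ≤-Reasoning

SunflowerFree : ℕ → Hypergraph n → Set
SunflowerFree p G = ∀ a → 2 ≤ a → ¬ HasSunflower a p G

module Reduction (2≤r : 2 ≤ r) (1≤ℓ : 1 ≤ ℓ) where

  ShrinkableTo : Hypergraph n → Subset n → Set
  ShrinkableTo H C =
    2 ≤ ∣ C ∣ × ∣ C ∣ ≤ r × Any (C ⊂_) (edges H) × ¬ HasLinearCycle ℓ (shrink C H)

  shrinkable? : (H : Hypergraph n) → Decidable (ShrinkableTo H)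
  shrinkable? H C = (2 ℕ.≤? ∣ C ∣) ×-dec (∣ C ∣ ℕ.≤? r) ×-dec
    Any.any? (C ⊂?_) (edges H) ×-dec ¬? (hasLinearCycle? ℓ (shrink C H))

  Irreducible : Hypergraph n → Set
  Irreducible H = ¬ ∃ (ShrinkableTo H)

  module _ {H : Hypergraph n} (sizes : EdgeSizesIn2to r H) (noCycle : ¬ HasLinearCycle ℓ H)
           (irreducible : Irreducible H) where

    irreducible-simple : IsSimple H
    irreducible-simple {e} {f} e∈H f∈H e⊆f with e ≟ₛ f
    ... | yes e≡f = e≡f
    ... | no  e≢f = contradiction
      (e , proj₁ (All.lookup sizes e∈H) , proj₂ (All.lookup sizes e∈H) ,
       lose f∈H (⊆∧≢⇒⊂ e⊆f e≢f) , shrink-edge-linearCycleFree e∈H noCycle)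
      irreducible

    irreducible-sunflowerFree : SunflowerFree (r * ℓ) H
    irreducible-sunflowerFree a 2≤a (S , C , S∈H , injective , ∣C∣≡a , sunflower) =
      let k , C⊂Sₖ = core⊂petal 2≤p sunflower injective in
      irreducible (C , 2≤C , ≤-trans (p⊆q⇒∣p∣≤∣q∣ (C⊆S k)) (rank (S∈H k)) ,
        lose (S∈H k) C⊂Sₖ ,
        shrink-core-linearCycleFree S rank S∈H sunflower C⊆S 2≤C
          (pred*<* (≤-trans (s≤s z≤n) 2≤r) 1≤ℓ) noCycle)
      where
      2≤p : 2 ≤ r * ℓ
      2≤p = *-mono-≤ 2≤r 1≤ℓ
      2≤C : 2 ≤ ∣ C ∣
      2≤C = subst (2 ≤_) (sym ∣C∣≡a) 2≤a
      C⊆S : ∀ k → C ⊆ S k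
      C⊆S = core⊆petal 2≤p sunflower
      rank : ∀ {e} → e ∈ edges H → ∣ e ∣ ≤ r
      rank e∈H = proj₂ (All.lookup sizes e∈H)

  reduce : (H : Hypergraph n) → Acc _<_ (weight H) →
           EdgeSizesIn2to r H → ¬ HasLinearCycle ℓ H →
           ∃ λ G′ → Refines G′ H × IsSimple G′ × EdgeSizesIn2to r G′ ×
                    ¬ HasLinearCycle ℓ G′ × SunflowerFree (r * ℓ) G′
  reduce H (acc smaller) sizes noCycle with anySubset? (shrinkable? H)
  ... | yes (C , 2≤C , C≤r , C⊂someEdge , noCycle′) =
    let k , k∈H , C⊂k = find C⊂someEdge
        G′ , G′≼shrunk , properties = reduce (shrink C H) (smaller (weight-shrink C⊂k k∈H))
                                    (shrink-edgeSizes 2≤C C≤r sizes) noCycle′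
    in G′ , refines-trans G′≼shrunk shrink-refines , properties
  ... | no irreducible =
    H , refines-refl , irreducible-simple sizes noCycle irreducible , sizes , noCycle ,
    irreducible-sunflowerFree sizes noCycle irreducible

lemma7p5 : ∀ (r ℓ : ℕ) → 2 ≤ r → 3 ≤ ℓ → ∀ {n} (G : Hypergraph n) →
    EdgeSizesIn2to r G → ¬ HasLinearCycle ℓ G →
    Σ (Hypergraph n) λ G′ →
      IsSimple G′ × EdgeSizesIn2to r G′ × ¬ HasLinearCycle ℓ G′ ×
      (∀ a → 2 ≤ a → ¬ HasSunflower a (r * ℓ) G′) × (α G′ ≤ α G)
lemma7p5 r ℓ 2≤r 3≤ℓ G sizes noCycle =
  let G′ , G′≼G , simple , sizes′ , noCycle′ , sunflowerFree =
        reduce G (<-wellFounded (weight G)) sizes noCycle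
  in G′ , simple , sizes′ , noCycle′ , sunflowerFree , α-refines G′≼G
  where open Reduction 2≤r (≤-trans (s≤s z≤n) 3≤ℓ)
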